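{- Let $k\geq 5$ be an integer and let $G$ be a connected graph of order \[n\geq \max\left\{k^2+k,\ \frac{\lfloor\frac{k}{2}\rfloor\cdot k(k-2)+k^2-5k+3}{k-4}\right\}.\] If $\deg(x)+\deg(y)\geq \frac{2n-2k+1}{k}$ for any two non-adjacent vertices $x$ and $y$ of $G$, then $G$ has at most $k-2$ cut edges.
   Context: All graphs are finite, simple and undirected; $\deg(x)$ is the degree of $x$ in $G$; a cut edge is an edge whose removal disconnects the graph. -}

module Defs where

open import Data.Nat using (ℕ; zero; suc; _+_; _*_; _∸_; _≤_; _<_; _/_)
open import Data.Fin using (Fin; toℕ)
open import Data.Bool using (Bool; true; false; _∧_; not)
open import Data.List using (List; length; filter; allFin)
open import Data.List.Relation.Unary.All using (All)
open import Data.List.Relation.Unary.Unique.Propositional using (Unique)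
open import Data.Product using (_×_; _,_)
open import Relation.Binary.PropositionalEquality using (_≡_; _≢_)
open import Relation.Nullary using (¬_)
open import Relation.Nullary.Decidable using (⌊_⌋)
open import Data.Fin using (_≟_)

record Graph (n : ℕ) : Set where
  field
    adj   : Fin n → Fin n → Bool
    sym   : ∀ x y → adj x y ≡ adj y x
    irrfl : ∀ x → adj x x ≡ false

open Graph public

Adj : ∀ {n} → Graph n → Fin n → Fin n → Set
Adj G x y = adj G x y ≡ true

deg : ∀ {n} → Graph n → Fin n → ℕ
deg {n} G x = length (filter (λ y → adj G x y Data.Bool.≟ true) (allFin n))
  where import Data.Bool

data Reach {n : ℕ} (A : Fin n → Fin n → Bool) (x : Fin n) : Fin n → Set where
  here : Reach A x x
  step : ∀ {y z} → Reach A x y → A y z ≡ true → Reach A x z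

Connected : ∀ {n} → Graph n → Set
Connected {n} G = ∀ (x y : Fin n) → Reach (adj G) x y

removeEdge : ∀ {n} → Graph n → Fin n → Fin n → Fin n → Fin n → Bool
removeEdge G u v x y =
  adj G x y ∧ not ((⌊ x ≟ u ⌋ ∧ ⌊ y ≟ v ⌋) Data.Bool.∨ (⌊ x ≟ v ⌋ ∧ ⌊ y ≟ u ⌋))
  where import Data.Bool

IsCutEdge : ∀ {n} → Graph n → Fin n → Fin n → Set
IsCutEdge {n} G u v =
  Adj G u v × ¬ (∀ (x y : Fin n) → Reach (removeEdge G u v) x y)

-- An edge {u,v} is represented by the ordered pair (u , v) with u < v.
-- "G has at most m cut edges": every duplicate-free list of cut edges
-- (each written with its smaller endpoint first) has length at most m.
AtMostCutEdges : ∀ {n} → Graph n → ℕ → Set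
AtMostCutEdges {n} G m =
  ∀ (es : List (Fin n × Fin n)) → Unique es →
    All (λ { (u , v) → (toℕ u < toℕ v) × IsCutEdge G u v }) es →
    length es ≤ m

-- Suppose G has t = k − 1 cut edges e_i = u_i v_i.  Give every
-- vertex x its signature: the vector recording, for each i, whether x lies on
-- the side of u_i in G − e_i.  The signature takes at least t + 1 values, so
-- choose t + 1 representatives with distinct signatures.  The hypothesis
-- gives deg x + deg y ≥ σ = ⌈(2n − 2k + 1)/k⌉ > 2t for non-adjacent x, y.
--   * If the class of a representative contains a vertex z on no e_i, all
--     neighbours of z share its signature, so the blocks {z} ∪ N(z) of these
--     "free" representatives are disjoint and pairwise non-adjacent.
--   * Otherwise ("covered" class) every neighbour of the representative p is
--     reached through a cut edge, so deg p ≤ t.  Two covered representatives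
--     are then forced to be joined by a cut edge, have degree sum ≤ t + 1,
--     and three of them would span a triangle of cut edges, impossible.
-- Counting the disjoint blocks inside the n vertices leaves three numerical
-- profiles (0, 1 or 2 covered classes), each refuted by the bounds on n.
--
-- Reachability is not decided constructively here, so the side of each edge
-- is obtained under a double negation, which is harmless for a goal ⊥.
module Submission where

open import Defs hiding (sym)
open import Data.Nat using (ℕ; zero; suc; _+_; _*_; _∸_; _≤_; _<_; _/_; _%_; z≤n; s≤s; s≤s⁻¹; _≤?_)
open import Data.Nat.Properties
open import Data.Nat.DivMod using (m≡m%n+[m/n]*n; m%n<n; m/n*n≤m; m*n/n≡m; /-monoˡ-≤)
open import Data.Nat.Tactic.RingSolver using (solve-∀)
open import Data.Fin as F using (Fin; toℕ; inject₁; fromℕ)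
import Data.Fin.Properties as FP
open import Data.Bool using (Bool; true; false; _∧_)
open import Data.Bool.Properties using (∧-comm; ∨-comm)
import Data.Bool as B
open import Data.List using (List; []; _∷_; length; filter; allFin; _++_; map; lookup)
import Data.List.Properties as LP
open import Data.Nat.ListAction using (sum)
open import Data.List.Relation.Unary.All as All using (All; []; _∷_)
open import Data.List.Relation.Unary.All.Properties as AllP using (¬Any⇒All¬)
open import Data.List.Relation.Unary.Any as Any using (here; there)
open import Data.List.Relation.Unary.AllPairs as AP using (AllPairs; []; _∷_)
open import Data.List.Relation.Unary.Unique.Propositional using (Unique)
import Data.List.Relation.Unary.Unique.Propositional.Properties as UP
open import Data.List.Membership.Propositional using (_∈_; find)
open import Data.List.Membership.Propositional.Properties
  using (∈-filter⁺; ∈-filter⁻; ∈-allFin; ∈-++⁻; ∈-lookup)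
open import Data.Product using (Σ; _×_; _,_; proj₁; proj₂)
open import Data.Sum using (_⊎_; inj₁; inj₂; [_,_]′)
open import Data.Empty using (⊥; ⊥-elim)
open import Function using (_∘_)
open import Relation.Nullary using (¬_; Dec; yes; no; ¬?)
open import Relation.Nullary.Decidable using (⌊_⌋; _×-dec_; _⊎-dec_; ¬¬-excluded-middle)
open import Relation.Binary.PropositionalEquality

true≢false : true ≢ false
true≢false ()

removeAt : ∀ {A : Set} {x : A} (ys : List A) → x ∈ ys → List A
removeAt (y ∷ ys) (here _)  = ys
removeAt (y ∷ ys) (there p) = y ∷ removeAt ys p

length-removeAt : ∀ {A : Set} {x : A} (ys : List A) (p : x ∈ ys) →
  suc (length (removeAt ys p)) ≡ length ys
length-removeAt (y ∷ ys) (here _)  = refl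
length-removeAt (y ∷ ys) (there p) = cong suc (length-removeAt ys p)

∈-removeAt : ∀ {A : Set} {x z : A} (ys : List A) (p : x ∈ ys) → z ∈ ys → z ≢ x → z ∈ removeAt ys p
∈-removeAt (y ∷ ys) (here refl) (here refl) z≢x = ⊥-elim (z≢x refl)
∈-removeAt (y ∷ ys) (here refl) (there q)   z≢x = q
∈-removeAt (y ∷ ys) (there p)   (here refl) z≢x = here refl
∈-removeAt (y ∷ ys) (there p)   (there q)   z≢x = there (∈-removeAt ys p q z≢x)

injection-length-≤ : ∀ {A B : Set} (R : A → B → Set) {xs : List A} {ys : List B} → Unique xs →
  (∀ {x} → x ∈ xs → Σ B λ b → b ∈ ys × R x b) →
  (∀ {x x' b} → x ∈ xs → x' ∈ xs → R x b → R x' b → x ≡ x') →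
  length xs ≤ length ys
injection-length-≤ R {[]} _ _ _ = z≤n
injection-length-≤ {A} {B} R {x ∷ xs} {ys} (x∉xs ∷ uxs) image inj with image (here refl)
... | b , b∈ , Rxb =
  subst (suc (length xs) ≤_) (length-removeAt ys b∈)
    (s≤s (injection-length-≤ R {xs} {removeAt ys b∈} uxs image′ (λ p q → inj (there p) (there q))))
  where
  image′ : ∀ {x'} → x' ∈ xs → Σ B λ b' → b' ∈ removeAt ys b∈ × R x' b'
  image′ x'∈ with image (there x'∈)
  ... | b' , b'∈ , Rx'b' =
    b' , ∈-removeAt ys b∈ b'∈ (λ { refl → All.lookup x∉xs x'∈ (sym (inj (there x'∈) (here refl) Rx'b' Rxb)) }) , Rx'b'

unique-⊆-length-≤ : ∀ {A : Set} {xs ys : List A} → Unique xs → (∀ {z} → z ∈ xs → z ∈ ys) →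
  length xs ≤ length ys
unique-⊆-length-≤ uxs sub =
  injection-length-≤ _≡_ uxs (λ z∈ → _ , sub z∈ , refl) (λ _ _ p q → trans p (sym q))

length-allFin : ∀ m → length (allFin m) ≡ m
length-allFin m = LP.length-tabulate (λ x → x)

length-filter-+ : ∀ {A : Set} {P Q : A → Set} (P? : ∀ x → Dec (P x)) (Q? : ∀ x → Dec (Q x)) (xs : List A) →
  length (filter P? xs) + length (filter Q? xs) ≤ length xs + length (filter (λ x → P? x ×-dec Q? x) xs)
length-filter-+ P? Q? [] = z≤n
length-filter-+ P? Q? (x ∷ xs) with P? x | Q? x | length-filter-+ P? Q? xs
... | yes _ | yes _ | ih = both ih
  where
  both : ∀ {a b c d} → a + b ≤ c + d → suc a + suc b ≤ suc c + suc d
  both {a} {b} {c} {d} h = s≤s (subst₂ _≤_ (sym (+-suc a b)) (sym (+-suc c d)) (s≤s h))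
... | yes _ | no _  | ih = s≤s ih
... | no _  | yes _ | ih = onlyQ ih
  where
  onlyQ : ∀ {a b c} → a + b ≤ c → a + suc b ≤ suc c
  onlyQ {a} {b} {c} h = subst (_≤ suc c) (sym (+-suc a b)) (s≤s h)
... | no _  | no _  | ih = ≤-trans ih (n≤1+n _)

AllPairs-∈ : ∀ {A : Set} {R : A → A → Set} {xs : List A} {x y : A} →
  AllPairs R xs → x ∈ xs → y ∈ xs → x ≢ y → R x y ⊎ R y x
AllPairs-∈ (a ∷ ap) (here refl) (here refl) x≢y = ⊥-elim (x≢y refl)
AllPairs-∈ (a ∷ ap) (here refl) (there q)   x≢y = inj₁ (All.lookup a q)
AllPairs-∈ (a ∷ ap) (there p)   (here refl) x≢y = inj₂ (All.lookup a p)
AllPairs-∈ (a ∷ ap) (there p)   (there q)   x≢y = AllPairs-∈ ap p q x≢y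

lookup-injective : ∀ {A : Set} {xs : List A} → Unique xs → ∀ i j → lookup xs i ≡ lookup xs j → i ≡ j
lookup-injective {xs = x ∷ xs} (x∉ ∷ ux) F.zero    F.zero    eq = refl
lookup-injective {xs = x ∷ xs} (x∉ ∷ ux) F.zero    (F.suc j) eq = ⊥-elim (All.lookup x∉ (∈-lookup j) eq)
lookup-injective {xs = x ∷ xs} (x∉ ∷ ux) (F.suc i) F.zero    eq = ⊥-elim (All.lookup x∉ (∈-lookup i) (sym eq))
lookup-injective {xs = x ∷ xs} (x∉ ∷ ux) (F.suc i) (F.suc j) eq = cong F.suc (lookup-injective ux i j eq)

¬¬-Π-Fin : ∀ {m} {P : Fin m → Set} → (∀ x → ¬ ¬ P x) → ¬ ¬ (∀ x → P x)
¬¬-Π-Fin {zero}      h k = k (λ ())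
¬¬-Π-Fin {suc m} {P} h k =
  h F.zero λ p₀ → ¬¬-Π-Fin {P = λ x → P (F.suc x)} (h ∘ F.suc) λ ps →
    k λ { F.zero → p₀ ; (F.suc x) → ps x }

module _ {n : ℕ} {A : Fin n → Fin n → Bool} where
  reach-trans : ∀ {x y z} → Reach A x y → Reach A y z → Reach A x z
  reach-trans p here       = p
  reach-trans p (step q e) = step (reach-trans p q) e

  reach-sym : (∀ a b → A a b ≡ A b a) → ∀ {x y} → Reach A x y → Reach A y x
  reach-sym s here                 = here
  reach-sym s (step {y} {z} q e) = reach-trans (step here (trans (s z y) e)) (reach-sym s q)

removeEdge-sym : ∀ {n} (G : Graph n) u v x y → removeEdge G u v x y ≡ removeEdge G u v y x
removeEdge-sym G u v x y
  rewrite Graph.sym G x y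
        | ∨-comm (⌊ x F.≟ u ⌋ ∧ ⌊ y F.≟ v ⌋) (⌊ x F.≟ v ⌋ ∧ ⌊ y F.≟ u ⌋)
        | ∧-comm ⌊ x F.≟ v ⌋ ⌊ y F.≟ u ⌋
        | ∧-comm ⌊ x F.≟ u ⌋ ⌊ y F.≟ v ⌋ = refl

⌊⌋-∧-false : ∀ {P Q : Set} (p : Dec P) (q : Dec Q) → ¬ (P × Q) → ⌊ p ⌋ ∧ ⌊ q ⌋ ≡ false
⌊⌋-∧-false (yes p) (yes q) ¬pq = ⊥-elim (¬pq (p , q))
⌊⌋-∧-false (yes p) (no _)  ¬pq = refl
⌊⌋-∧-false (no _)  _       ¬pq = refl

removeEdge-keeps : ∀ {n} (G : Graph n) u v x y → Adj G x y → ¬ (x ≡ u × y ≡ v) → ¬ (x ≡ v × y ≡ u) →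
  removeEdge G u v x y ≡ true
removeEdge-keeps G u v x y a h₁ h₂
  rewrite a | ⌊⌋-∧-false (x F.≟ u) (y F.≟ v) h₁ | ⌊⌋-∧-false (x F.≟ v) (y F.≟ u) h₂ = refl

-- In a connected graph the ends of a cut edge are separated by its removal:
-- otherwise every walk of G could be rerouted inside G − uv.
cut-edge-separates : ∀ {n} (G : Graph n) → Connected G → ∀ u v → IsCutEdge G u v →
  ¬ Reach (removeEdge G u v) u v
cut-edge-separates {n} G conn u v (_ , disconnected) u~v = disconnected (λ x y → reroute (conn x y))
  where
  reroute : ∀ {x y} → Reach (adj G) x y → Reach (removeEdge G u v) x y
  reroute here = here
  reroute (step {b} {c} p e) with (b F.≟ u ×-dec c F.≟ v) | (b F.≟ v ×-dec c F.≟ u)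
  ... | yes (refl , refl) | _                 = reach-trans (reroute p) u~v
  ... | no _              | yes (refl , refl) = reach-trans (reroute p) (reach-sym (removeEdge-sym G u v) u~v)
  ... | no h₁             | no h₂             = step (reroute p) (removeEdge-keeps G u v b c e h₁ h₂)

Same : ∀ {V : Set} {t} → (V → Fin t → Bool) → V → V → Set
Same sg x y = ∀ i → sg x i ≡ sg y i

same? : ∀ {V : Set} {t} (sg : V → Fin t → Bool) x y → Dec (Same sg x y)
same? sg x y = FP.all? (λ i → sg x i B.≟ sg y i)

-- If for every coordinate i there are two points p i, q i whose signatures
-- differ exactly in coordinate i, then the signature takes at least t + 1
-- distinct values.  (Induction on t: the points p t, q t agree on the first
-- t coordinates, so they cannot both repeat a value already found.)
distinct-signatures : ∀ {V : Set} t (sg : V → Fin t → Bool) (p q : Fin t → V) →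
  (∀ i → sg (p i) i ≢ sg (q i) i) →
  (∀ i j → j ≢ i → sg (p i) j ≡ sg (q i) j) →
  V → Σ (List V) λ R → length R ≡ suc t × AllPairs (λ a b → ¬ Same sg a b) R
distinct-signatures zero sg p q differ agree x₀ = x₀ ∷ [] , refl , [] ∷ []
distinct-signatures {V} (suc t) sg p q differ agree x₀
  with distinct-signatures t sg′ (p ∘ inject₁) (q ∘ inject₁) (differ ∘ inject₁)
         (λ i j j≢i → agree (inject₁ i) (inject₁ j) (j≢i ∘ FP.inject₁-injective)) x₀
  where
  sg′ : V → Fin t → Bool
  sg′ a i = sg a (inject₁ i)
... | R , |R| , apR = extend
  where
  P = p (fromℕ t)
  Q = q (fromℕ t)
  sg′ : V → Fin t → Bool
  sg′ a i = sg a (inject₁ i)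
  apR′ : AllPairs (λ a b → ¬ Same sg a b) R
  apR′ = AP.map (λ ns s → ns (λ i → s (inject₁ i))) apR
  PQ-agree : ∀ i → sg P (inject₁ i) ≡ sg Q (inject₁ i)
  PQ-agree i = agree (fromℕ t) (inject₁ i) (λ e → FP.fromℕ≢inject₁ (sym e))
  extend : Σ (List V) λ R → length R ≡ suc (suc t) × AllPairs (λ a b → ¬ Same sg a b) R
  extend with Any.any? (same? sg P) R
  ... | no P-new = P ∷ R , cong suc |R| , ¬Any⇒All¬ R P-new ∷ apR′
  ... | yes P-old with Any.any? (same? sg Q) R
  ...   | no Q-new = Q ∷ R , cong suc |R| , ¬Any⇒All¬ R Q-new ∷ apR′
  ...   | yes Q-old with find P-old | find Q-old
  ...     | w₁ , w₁∈ , s₁ | w₂ , w₂∈ , s₂ =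
    ⊥-elim ([ (λ d → d s₁₂) , (λ d → d (λ i → sym (s₁₂ i))) ]′ (AllPairs-∈ apR w₁∈ w₂∈ w₁≢w₂))
    where
    s₁₂ : Same sg′ w₁ w₂
    s₁₂ i = trans (sym (s₁ (inject₁ i))) (trans (PQ-agree i) (s₂ (inject₁ i)))
    w₁≢w₂ : w₁ ≢ w₂
    w₁≢w₂ refl = differ (fromℕ t) (trans (s₁ (fromℕ t)) (sym (s₂ (fromℕ t))))

-- Arithmetic.  σ will be ⌈D/K⌉ for D = 2n − 2K + 1, so the degree-sum
-- hypothesis reads deg x + deg y ≥ σ.

-- Σ (d + 1): the number of vertices in blocks {z} ∪ N(z) of degrees d.
sumSuc : List ℕ → ℕ
sumSuc []       = 0
sumSuc (d ∷ ds) = suc d + sumSuc ds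

sumSuc≡sum+length : ∀ ds → sumSuc ds ≡ sum ds + length ds
sumSuc≡sum+length []       = refl
sumSuc≡sum+length (d ∷ ds) = trans (cong (suc d +_) (sumSuc≡sum+length ds)) (shift d (sum ds) (length ds))
  where
  shift : ∀ d s l → suc d + (s + l) ≡ (d + s) + suc l
  shift = solve-∀

≤-excess-absurd : ∀ {a b} c → a ≤ b → a ≡ suc (b + c) → ⊥
≤-excess-absurd {a} {b} c a≤b eq = <-irrefl refl (≤-trans (s≤s (m≤m+n b c)) (subst (_≤ b) eq a≤b))

sum-lower-bound : ∀ {σ x} ys → All (λ y → σ ≤ x + y) ys → length ys * σ ≤ length ys * x + sum ys
sum-lower-bound [] _ = z≤n
sum-lower-bound {σ} {x} (y ∷ ys) (h ∷ hs) =
  subst₂ _≤_ refl (regroup x y (length ys) (sum ys)) (+-mono-≤ h (sum-lower-bound ys hs))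
  where
  regroup : ∀ x y m s → (x + y) + (m * x + s) ≡ (x + m * x) + (y + s)
  regroup = solve-∀

-- If any two of at least two numbers sum to at least σ, then their count
-- times σ is at most twice their sum.  (If the first number x satisfies
-- 2x ≥ σ use induction; otherwise every other number exceeds σ − x.)
pairwise-sum-bound : ∀ {σ} xs → AllPairs (λ a b → σ ≤ a + b) xs → 2 ≤ length xs →
  length xs * σ ≤ 2 * sum xs
pairwise-sum-bound (x ∷ [])  _ (s≤s ())
pairwise-sum-bound {σ} (x ∷ y ∷ []) ((h ∷ []) ∷ _) _ =
  subst (2 * σ ≤_) (cong (λ z → 2 * (x + z)) (sym (+-identityʳ y))) (*-monoʳ-≤ 2 h)
pairwise-sum-bound {σ} (x ∷ y ∷ z ∷ zs) (x-pairs ∷ ap) _ with σ ≤? x + x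
... | yes σ≤2x =
  subst₂ _≤_ refl (double x (sum (y ∷ z ∷ zs)))
    (+-mono-≤ σ≤2x (pairwise-sum-bound (y ∷ z ∷ zs) ap (s≤s (s≤s z≤n))))
  where
  double : ∀ x s → (x + x) + 2 * s ≡ 2 * (x + s)
  double = solve-∀
... | no σ≰2x = combine σ x (sum (y ∷ z ∷ zs)) (suc (length zs))
                  (sum-lower-bound (y ∷ z ∷ zs) x-pairs) (<⇒≤ (≰⇒> σ≰2x))
  where
  combine : ∀ σ x s m → suc m * σ ≤ suc m * x + s → x + x ≤ σ → suc (suc m) * σ ≤ 2 * (x + s)
  combine σ x s m h₁ h₂ =
    +-cancelˡ-≤ (m * σ + m * (x + x)) _ _
      (subst₂ _≤_ (l₁ σ x s m) (l₂ σ x s m) (+-mono-≤ (*-monoʳ-≤ 2 h₁) (*-monoʳ-≤ m h₂)))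
    where
    l₁ : ∀ σ x s m → 2 * (suc m * σ) + m * (x + x) ≡ (m * σ + m * (x + x)) + suc (suc m) * σ
    l₁ = solve-∀
    l₂ : ∀ σ x s m → 2 * (suc m * x + s) + m * σ ≡ (m * σ + m * (x + x)) + 2 * (x + s)
    l₂ = solve-∀

ceiling-spec : ∀ D t → (D ≤ suc t * ((D + t) / suc t)) × (∀ x → D ≤ suc t * x → (D + t) / suc t ≤ x)
ceiling-spec D t = upper , least
  where
  K = suc t
  σ = (D + t) / K
  r = (D + t) % K
  division : D + t ≡ r + σ * K
  division = m≡m%n+[m/n]*n (D + t) K
  r≤t : r ≤ t
  r≤t = s≤s⁻¹ (m%n<n (D + t) K)
  upper : D ≤ K * σ
  upper with D ≤? K * σ
  ... | yes p = p
  ... | no np = ⊥-elim (≤-excess-absurd 0 (+-mono-≤ (≰⇒> np) r≤t) (trans (l₁ t r σ) (cong suc (sym lhs))))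
    where
    lhs : (D + t) + 0 ≡ r + σ * K
    lhs = trans (+-identityʳ (D + t)) division
    l₁ : ∀ t r σ → suc (suc t * σ) + r ≡ suc (r + σ * suc t)
    l₁ = solve-∀
  least : ∀ x → D ≤ K * x → σ ≤ x
  least x le with σ ≤? x
  ... | yes p = p
  ... | no np = ⊥-elim (≤-excess-absurd 0 (+-mono-≤ (+-mono-≤ (*-monoʳ-≤ K (≰⇒> np)) (m/n*n≤m (D + t) K)) le)
                  (l₂ D t σ x))
    where
    l₂ : ∀ D t σ x → suc t * suc x + σ * suc t + D ≡ suc (suc t * σ + (D + t) + suc t * x + 0)
    l₂ = solve-∀

threshold-identity : ∀ K n → K ≤ n → (2 * n ∸ 2 * K + 1) + 2 * K ≡ 2 * n + 1
threshold-identity K n K≤n =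
  trans (swap (2 * n ∸ 2 * K) (2 * K) 1) (cong (_+ 1) (m∸n+n≡m (*-monoʳ-≤ 2 K≤n)))
  where
  swap : ∀ X Y c → (X + c) + Y ≡ (X + Y) + c
  swap = solve-∀

threshold-large : ∀ K σ n D → D ≤ K * σ → K * K + K ≤ n → D + 2 * K ≡ 2 * n + 1 → suc (K + K) ≤ σ
threshold-large K σ n D D≤Kσ big-n D+2K with suc (K + K) ≤? σ
... | yes p = p
... | no np = ⊥-elim (≤-excess-absurd 0
        (+-mono-≤ (+-mono-≤ (≤-trans D≤Kσ (*-monoʳ-≤ K (s≤s⁻¹ (≰⇒> np)))) (*-monoʳ-≤ 2 big-n))
          (≤-reflexive (sym D+2K)))
        (expand K n D))
  where
  expand : ∀ K n D → D + 2 * (K * K + K) + (2 * n + 1) ≡ suc (K * (K + K) + 2 * n + (D + 2 * K) + 0)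
  expand = solve-∀

-- The three possible outcomes of the structural analysis, recorded as
-- degree data: ds are the degrees of the free representatives, which must
-- fit (with their blocks and the covered representatives) into n vertices.
data Profile (n t σ : ℕ) : Set where
  -- t + 1 free representatives, pairwise non-adjacent
  noCovered  : (ds : List ℕ) → length ds ≡ suc t → AllPairs (λ a b → σ ≤ a + b) ds →
               sumSuc ds ≤ n → Profile n t σ
  -- t free representatives and one covered one, of degree ≤ t
  oneCovered : (ds : List ℕ) → length ds ≡ t → All (λ a → σ ≤ a + t) ds →
               sumSuc ds + 1 ≤ n → Profile n t σ
  -- t − 1 free representatives and two covered ones, the smaller degree c
  -- satisfying 2c ≤ t + 1
  twoCovered : (ds : List ℕ) (c : ℕ) → suc (length ds) ≡ t → c + c ≤ suc t →
               All (λ a → σ ≤ a + c) ds → sumSuc ds + 2 ≤ n → Profile n t σ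

-- No covered class: Kσ ≤ 2 Σ d ≤ 2(n − K) contradicts Kσ ≥ 2n − 2K + 1.
noCovered-impossible : ∀ K σ n D ds → length ds ≡ K → 2 ≤ K → AllPairs (λ a b → σ ≤ a + b) ds →
  sumSuc ds ≤ n → D ≤ K * σ → D + 2 * K ≡ 2 * n + 1 → ⊥
noCovered-impossible K σ n D ds |ds| 2≤K pairs fits D≤Kσ D+2K =
  ≤-excess-absurd 0 (+-cancelˡ-≤ (K * σ + 2 * S) _ _ combined) 
    (trans D+2K (trans (+-comm (2 * n) 1) (cong suc (sym (+-identityʳ (2 * n))))))
  where
  S = sum ds
  Kσ≤2S : K * σ ≤ 2 * S
  Kσ≤2S = subst (λ l → l * σ ≤ 2 * S) |ds| (pairwise-sum-bound ds pairs (subst (2 ≤_) (sym |ds|) 2≤K))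
  S+K≤n : S + K ≤ n
  S+K≤n = subst (_≤ n) (trans (sumSuc≡sum+length ds) (cong (S +_) |ds|)) fits
  combined : (K * σ + 2 * S) + (D + 2 * K) ≤ (K * σ + 2 * S) + 2 * n
  combined = subst₂ _≤_ (l₁ K σ S D) (l₂ K σ S n) (+-mono-≤ (+-mono-≤ Kσ≤2S (*-monoʳ-≤ 2 S+K≤n)) D≤Kσ)
    where
    l₁ : ∀ K σ S D → (K * σ + 2 * (S + K)) + D ≡ (K * σ + 2 * S) + (D + 2 * K)
    l₁ = solve-∀
    l₂ : ∀ K σ S n → (2 * S + 2 * n) + K * σ ≡ (K * σ + 2 * S) + 2 * n
    l₂ = solve-∀

-- One covered class (k = 5 + a, t = k − 1): summing σ ≤ d + t over the t
-- free degrees and using σ ≥ 2k + 1 leaves no room in n vertices.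
oneCovered-impossible : ∀ a σ n D ds → length ds ≡ 4 + a → All (λ d → σ ≤ d + (4 + a)) ds →
  sumSuc ds + 1 ≤ n → D ≤ (5 + a) * σ → D + 2 * (5 + a) ≡ 2 * n + 1 → suc ((5 + a) + (5 + a)) ≤ σ → ⊥
oneCovered-impossible a σ n D ds |ds| bounds fits D≤Kσ D+2K σ-large =
  ≤-excess-absurd (1 + a) combined (expand a σ n D S)
  where
  S = sum ds
  t = 4 + a
  K = 5 + a
  tσ≤ : t * σ ≤ t * t + S
  tσ≤ = subst (λ l → l * σ ≤ l * t + S) |ds|
          (sum-lower-bound ds (All.map (λ {d} le → subst (σ ≤_) (+-comm d t) le) bounds))
  S+t+1≤n : (S + t) + 1 ≤ n
  S+t+1≤n = subst (λ w → w + 1 ≤ n) (trans (sumSuc≡sum+length ds) (cong (S +_) |ds|)) fits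
  combined : 2 * (t * σ) + 2 * ((S + t) + 1) + D + (3 + a) * suc (K + K) + (2 * n + 1)
           ≤ 2 * (t * t + S) + 2 * n + K * σ + (3 + a) * σ + (D + 2 * K)
  combined = +-mono-≤ (+-mono-≤ (+-mono-≤ (+-mono-≤ (*-monoʳ-≤ 2 tσ≤) (*-monoʳ-≤ 2 S+t+1≤n)) D≤Kσ)
               (*-monoʳ-≤ (3 + a) σ-large))
               (≤-reflexive (sym D+2K))
  expand : ∀ a σ n D S →
    2 * ((4 + a) * σ) + 2 * ((S + (4 + a)) + 1) + D + (3 + a) * suc ((5 + a) + (5 + a)) + (2 * n + 1)
    ≡ suc (2 * ((4 + a) * (4 + a) + S) + 2 * n + (5 + a) * σ + (3 + a) * σ + (D + 2 * (5 + a)) + (1 + a))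
  expand = solve-∀

-- Two covered classes: here c ≤ ⌊k/2⌋ and the second bound on n is exactly
-- what is needed to refute the count.
twoCovered-impossible : ∀ a σ n D c ds → suc (length ds) ≡ 4 + a → c + c ≤ 5 + a →
  All (λ d → σ ≤ d + c) ds → sumSuc ds + 2 ≤ n → D ≤ (5 + a) * σ → D + 2 * (5 + a) ≡ 2 * n + 1 →
  ((5 + a) / 2) * ((5 + a) * ((5 + a) ∸ 2)) + (5 + a) * (5 + a) ∸ 5 * (5 + a) + 3 ≤ n * ((5 + a) ∸ 4) → ⊥
twoCovered-impossible a σ n D c ds |ds|+1 2c≤K bounds fits D≤Kσ D+2K big-n =
  ≤-excess-absurd 0 combined (expand a σ n D S h)
  where
  S = sum ds
  K = 5 + a
  h = K / 2
  c≤h : c ≤ h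
  c≤h = subst (_≤ h) (m*n/n≡m c 2)
          (/-monoˡ-≤ 2 (subst (_≤ K) (trans (cong (c +_) (sym (+-identityʳ c))) (*-comm 2 c)) 2c≤K))
  bounds′ : All (λ d → σ ≤ h + d) ds
  bounds′ = All.map (λ {d} le → subst (σ ≤_) (+-comm d h) (≤-trans le (+-monoʳ-≤ d c≤h))) bounds
  |ds| : length ds ≡ 3 + a
  |ds| = suc-injective |ds|+1
  sσ≤ : (3 + a) * σ ≤ (3 + a) * h + S
  sσ≤ = subst (λ l → l * σ ≤ l * h + S) |ds| (sum-lower-bound ds bounds′)
  S+s+2≤n : (S + (3 + a)) + 2 ≤ n
  S+s+2≤n = subst (λ w → w + 2 ≤ n) (trans (sumSuc≡sum+length ds) (cong (S +_) |ds|)) fits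
  W = h * (K * (3 + a)) + K * K
  5K≤W : 5 * K ≤ W
  5K≤W = ≤-trans (*-monoˡ-≤ K {5} {K} (s≤s (s≤s (s≤s (s≤s (s≤s z≤n)))))) (m≤n+m (K * K) (h * (K * (3 + a))))
  big-n′ : W + 3 ≤ n * (1 + a) + 5 * K
  big-n′ = subst (_≤ n * (1 + a) + 5 * K)
             (trans (swap (W ∸ 5 * K) (5 * K) 3) (cong (_+ 3) (m∸n+n≡m 5K≤W)))
             (+-monoˡ-≤ (5 * K) big-n)
    where
    swap : ∀ X Y c → (X + c) + Y ≡ (X + Y) + c
    swap = solve-∀
  combined : K * ((3 + a) * σ) + K * ((S + (3 + a)) + 2) + (3 + a) * D + (3 + a) * (2 * n + 1) + (W + 3)
           ≤ K * ((3 + a) * h + S) + K * n + (3 + a) * (K * σ) + (3 + a) * (D + 2 * K) + (n * (1 + a) + 5 * K)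
  combined = +-mono-≤ (+-mono-≤ (+-mono-≤ (+-mono-≤ (*-monoʳ-≤ K sσ≤) (*-monoʳ-≤ K S+s+2≤n))
               (*-monoʳ-≤ (3 + a) D≤Kσ)) (*-monoʳ-≤ (3 + a) (≤-reflexive (sym D+2K)))) big-n′
  expand : ∀ a σ n D S h →
    (5 + a) * ((3 + a) * σ) + (5 + a) * ((S + (3 + a)) + 2) + (3 + a) * D + (3 + a) * (2 * n + 1)
      + ((h * ((5 + a) * (3 + a)) + (5 + a) * (5 + a)) + 3)
    ≡ suc ((5 + a) * ((3 + a) * h + S) + (5 + a) * n + (3 + a) * ((5 + a) * σ) + (3 + a) * (D + 2 * (5 + a))
      + (n * (1 + a) + 5 * (5 + a)) + 0)
  expand = solve-∀

module Threshold (a n : ℕ) where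
  K t D σ : ℕ
  K = 5 + a
  t = 4 + a
  D = 2 * n ∸ 2 * K + 1
  σ = (D + t) / K

  D≤Kσ : D ≤ K * σ
  D≤Kσ = proj₁ (ceiling-spec D t)

  -- the degree-sum hypothesis, divided by k
  σ-≤ : ∀ s → D ≤ K * s → σ ≤ s
  σ-≤ = proj₂ (ceiling-spec D t)

  module _ (big-n : K * K + K ≤ n) where
    D+2K : D + 2 * K ≡ 2 * n + 1
    D+2K = threshold-identity K n (≤-trans (m≤n+m K (K * K)) big-n)

    σ-large : suc (K + K) ≤ σ
    σ-large = threshold-large K σ n D D≤Kσ big-n D+2K

    2t<σ : t + t < σ
    2t<σ = ≤-trans (s≤s (+-mono-≤ (n≤1+n t) (n≤1+n t))) σ-large

    profile-impossible : (K / 2) * (K * (K ∸ 2)) + K * K ∸ 5 * K + 3 ≤ n * (K ∸ 4) → Profile n t σ → ⊥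
    profile-impossible _ (noCovered ds |ds| pairs fits) =
      noCovered-impossible K σ n D ds |ds| (s≤s (s≤s z≤n)) pairs fits D≤Kσ D+2K
    profile-impossible _ (oneCovered ds |ds| bounds fits) =
      oneCovered-impossible a σ n D ds |ds| bounds fits D≤Kσ D+2K σ-large
    profile-impossible big-n₂ (twoCovered ds c |ds|+1 2c≤K bounds fits) =
      twoCovered-impossible a σ n D c ds |ds|+1 2c≤K bounds fits D≤Kσ D+2K big-n₂

record CutEdges {n} (G : Graph n) (t : ℕ) : Set where
  field
    u v      : Fin t → Fin n
    ordered  : ∀ i → toℕ (u i) < toℕ (v i)
    cut      : ∀ i → IsCutEdge G (u i) (v i)
    distinct : ∀ i j → u i ≡ u j → v i ≡ v j → i ≡ j

cutEdges-prefix : ∀ {n} (G : Graph n) t (es : List (Fin n × Fin n)) → Unique es →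
  All (λ { (u , v) → (toℕ u < toℕ v) × IsCutEdge G u v }) es → t ≤ length es → CutEdges G t
cutEdges-prefix G t es ues props t≤|es| = record
  { u        = proj₁ ∘ edge
  ; v        = proj₂ ∘ edge
  ; ordered  = λ i → proj₁ (prop i)
  ; cut      = λ i → proj₂ (prop i)
  ; distinct = λ i j p q →
      FP.inject≤-injective t≤|es| t≤|es| i j (lookup-injective ues _ _ (cong₂ _,_ p q))
  }
  where
  edge : Fin t → Fin _ × Fin _
  edge i = lookup es (F.inject≤ i t≤|es|)
  prop : ∀ i → (toℕ (proj₁ (edge i)) < toℕ (proj₂ (edge i))) × IsCutEdge G (proj₁ (edge i)) (proj₂ (edge i))
  prop i = All.lookup props (∈-lookup (F.inject≤ i t≤|es|))

module CutEdgeAnalysis {n t : ℕ} (G : Graph n) (conn : Connected G) (E : CutEdges G t)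
  (side? : ∀ i x → Dec (Reach (removeEdge G (CutEdges.u E i) (CutEdges.v E i)) (CutEdges.u E i) x))
  (σ : ℕ) (deg-sum : ∀ x y → x ≢ y → ¬ Adj G x y → σ ≤ deg G x + deg G y)
  (2t<σ : t + t < σ)
  where
  open CutEdges E

  side : Fin n → Fin t → Bool
  side x i = ⌊ side? i x ⌋

  Apart : Fin n → Fin n → Set
  Apart x y = ¬ Same side x y

  apart-sym : ∀ {x y} → Apart x y → Apart y x
  apart-sym d s = d (λ i → sym (s i))

  apart-resp : ∀ {x r z} → Apart x r → Same side r z → Apart x z
  apart-resp d s s′ = d (λ i → trans (s′ i) (sym (s i)))

  apart-≢ : ∀ {x y} → Apart x y → x ≢ y
  apart-≢ d refl = d (λ i → refl)

  u≢v : ∀ i → u i ≢ v i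
  u≢v i e = <-irrefl (cong toℕ e) (ordered i)

  side-u : ∀ i → side (u i) i ≡ true
  side-u i with side? i (u i)
  ... | yes _ = refl
  ... | no ¬r = ⊥-elim (¬r here)

  side-v : ∀ i → side (v i) i ≡ false
  side-v i with side? i (v i)
  ... | yes r = ⊥-elim (cut-edge-separates G conn (u i) (v i) (cut i) r)
  ... | no _  = refl

  OnEdge : Fin t → Fin n → Fin n → Set
  OnEdge i x y = (x ≡ u i × y ≡ v i) ⊎ (x ≡ v i × y ≡ u i)

  onEdge? : ∀ i x y → Dec (OnEdge i x y)
  onEdge? i x y = (x F.≟ u i ×-dec y F.≟ v i) ⊎-dec (x F.≟ v i ×-dec y F.≟ u i)

  onEdge-sym : ∀ {i a b} → OnEdge i a b → OnEdge i b a
  onEdge-sym (inj₁ (x , y)) = inj₂ (y , x)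
  onEdge-sym (inj₂ (x , y)) = inj₁ (y , x)

  onEdge-other : ∀ {i a b c} → OnEdge i a b → OnEdge i a c → b ≡ c
  onEdge-other (inj₁ (_ , p)) (inj₁ (_ , q)) = trans p (sym q)
  onEdge-other (inj₂ (_ , p)) (inj₂ (_ , q)) = trans p (sym q)
  onEdge-other {i} (inj₁ (p , _)) (inj₂ (q , _)) = ⊥-elim (u≢v i (trans (sym p) q))
  onEdge-other {i} (inj₂ (p , _)) (inj₁ (q , _)) = ⊥-elim (u≢v i (trans (sym q) p))

  onEdge-side : ∀ {i a b} → OnEdge i a b → side a i ≢ side b i
  onEdge-side {i} (inj₁ (refl , refl)) e = true≢false (trans (sym (side-u i)) (trans e (side-v i)))
  onEdge-side {i} (inj₂ (refl , refl)) e = true≢false (trans (sym (side-u i)) (trans (sym e) (side-v i)))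

  side-edge : ∀ i x y → Adj G x y → ¬ OnEdge i x y → side x i ≡ side y i
  side-edge i x y a ¬e with side? i x | side? i y
  ... | yes _ | yes _ = refl
  ... | no _  | no _  = refl
  ... | yes p | no q  = ⊥-elim (q (step p (removeEdge-keeps G (u i) (v i) x y a (¬e ∘ inj₁) (¬e ∘ inj₂))))
  ... | no q  | yes p = ⊥-elim (q (step p (trans (removeEdge-sym G (u i) (v i) y x)
                                              (removeEdge-keeps G (u i) (v i) x y a (¬e ∘ inj₁) (¬e ∘ inj₂)))))

  -- edge j is not edge i (edges are stored with the smaller end first)
  other-edge : ∀ i j → j ≢ i → ¬ OnEdge i (u j) (v j)
  other-edge i j j≢i (inj₁ (p , q)) = j≢i (distinct j i p q)
  other-edge i j j≢i (inj₂ (p , q)) =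
    <-irrefl refl (<-trans (ordered j) (subst (_< toℕ (u j)) (cong toℕ (sym q))
                   (subst (toℕ (u i) <_) (cong toℕ (sym p)) (ordered i))))

  side-other-edge : ∀ i j → j ≢ i → side (u j) i ≡ side (v j) i
  side-other-edge i j j≢i = side-edge i (u j) (v j) (proj₁ (cut j)) (other-edge i j j≢i)

  representatives : Fin n → Σ (List (Fin n)) λ R → length R ≡ suc t × AllPairs Apart R
  representatives = distinct-signatures t side u v (λ i → onEdge-side (inj₁ (refl , refl)))
                      (λ i j j≢i → side-other-edge j i (j≢i ∘ sym))

  EndOf : Fin t → Fin n → Set
  EndOf i x = x ≡ u i ⊎ x ≡ v i

  onEdge-end : ∀ {i a b} → OnEdge i a b → EndOf i a
  onEdge-end (inj₁ (p , _)) = inj₁ p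
  onEdge-end (inj₂ (p , _)) = inj₂ p

  ends-same : ∀ i {a b} → EndOf i a → EndOf i b → Same side a b → a ≡ b
  ends-same i (inj₁ refl) (inj₁ refl) s = refl
  ends-same i (inj₂ refl) (inj₂ refl) s = refl
  ends-same i (inj₁ refl) (inj₂ refl) s = ⊥-elim (onEdge-side (inj₁ (refl , refl)) (s i))
  ends-same i (inj₂ refl) (inj₁ refl) s = ⊥-elim (onEdge-side (inj₂ (refl , refl)) (s i))

  ends-agree : ∀ {i i₀ a b} → i ≢ i₀ → EndOf i a → EndOf i b → side a i₀ ≡ side b i₀
  ends-agree i≢i₀ (inj₁ refl) (inj₁ refl) = refl
  ends-agree i≢i₀ (inj₂ refl) (inj₂ refl) = refl
  ends-agree {i} {i₀} i≢i₀ (inj₁ refl) (inj₂ refl) = side-other-edge i₀ i i≢i₀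
  ends-agree {i} {i₀} i≢i₀ (inj₂ refl) (inj₁ refl) = sym (side-other-edge i₀ i i≢i₀)

  Incident : Fin n → Set
  Incident y = Σ (Fin t) λ i → EndOf i y

  incident? : ∀ y → Dec (Incident y)
  incident? y = FP.any? (λ i → (y F.≟ u i) ⊎-dec (y F.≟ v i))

  free-neighbour : ∀ z y → ¬ Incident z → Adj G z y → Same side z y
  free-neighbour z y ¬inc a i = side-edge i z y a (λ e → ¬inc (i , onEdge-end e))

  free-deg-sum : ∀ z w → ¬ Incident z → Apart z w → σ ≤ deg G z + deg G w
  free-deg-sum z w ¬inc d = deg-sum z w (apart-≢ d) (λ a → d (free-neighbour z w ¬inc a))

  Covered : Fin n → Set
  Covered p = ∀ y → Same side p y → Incident y

  -- Replace each representative whose class contains a free vertex by such a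
  -- vertex (zs); the other, covered, representatives are kept (ps).
  record Split (R : List (Fin n)) : Set where
    field
      zs ps   : List (Fin n)
      |zs+ps| : length zs + length ps ≡ length R
      free    : All (λ z → ¬ Incident z) zs
      covered : All Covered ps
      apart-z : AllPairs Apart zs
      apart-p : AllPairs Apart ps
      apart-zp : All (λ z → All (Apart z) ps) zs
      keeps-apart : ∀ x → All (Apart x) R → All (Apart x) zs × All (Apart x) ps

  apart-cons : ∀ r {zs ps} → All (Apart r) zs → All (λ z → All (Apart z) ps) zs →
    All (λ z → All (Apart z) (r ∷ ps)) zs
  apart-cons r []       []       = []
  apart-cons r (d ∷ ds) (c ∷ cs) = (apart-sym d ∷ c) ∷ apart-cons r ds cs

  split : ∀ R → AllPairs Apart R → Split R
  split [] [] = record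
    { zs = [] ; ps = [] ; |zs+ps| = refl ; free = [] ; covered = [] ; apart-z = [] ; apart-p = []
    ; apart-zp = [] ; keeps-apart = λ x _ → [] , [] }
  split (r ∷ R) (r-apart ∷ ap) with split R ap | FP.any? (λ y → same? side r y ×-dec ¬? (incident? y))
  ... | S | yes (z , s , ¬inc) = record
    { zs = z ∷ Split.zs S ; ps = Split.ps S ; |zs+ps| = cong suc (Split.|zs+ps| S)
    ; free = ¬inc ∷ Split.free S ; covered = Split.covered S
    ; apart-z = All.map (λ d → apart-sym (apart-resp (apart-sym d) s)) (proj₁ (Split.keeps-apart S r r-apart))
                ∷ Split.apart-z S
    ; apart-p = Split.apart-p S
    ; apart-zp = All.map (λ d → apart-sym (apart-resp (apart-sym d) s)) (proj₂ (Split.keeps-apart S r r-apart))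
                 ∷ Split.apart-zp S
    ; keeps-apart = λ { x (d ∷ ds) → (apart-resp d s ∷ proj₁ (Split.keeps-apart S x ds))
                                   , proj₂ (Split.keeps-apart S x ds) } }
  ... | S | no no-free = record
    { zs = Split.zs S ; ps = r ∷ Split.ps S
    ; |zs+ps| = trans (+-suc (length (Split.zs S)) (length (Split.ps S))) (cong suc (Split.|zs+ps| S))
    ; free = Split.free S ; covered = r-covered ∷ Split.covered S
    ; apart-z = Split.apart-z S
    ; apart-p = proj₂ (Split.keeps-apart S r r-apart) ∷ Split.apart-p S
    ; apart-zp = apart-cons r (proj₁ (Split.keeps-apart S r r-apart)) (Split.apart-zp S)
    ; keeps-apart = λ { x (d ∷ ds) → proj₁ (Split.keeps-apart S x ds) , (d ∷ proj₂ (Split.keeps-apart S x ds)) } }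
    where
    r-covered : Covered r
    r-covered y s with incident? y
    ... | yes inc = inc
    ... | no ¬inc = ⊥-elim (no-free (y , s , ¬inc))

  N : Fin n → List (Fin n)
  N z = filter (λ y → adj G z y B.≟ true) (allFin n)

  N-adj : ∀ {z y} → y ∈ N z → Adj G z y
  N-adj {z} p = proj₂ (∈-filter⁻ (λ y → adj G z y B.≟ true) {xs = allFin n} p)

  N-unique : ∀ z → Unique (N z)
  N-unique z = UP.filter⁺ (λ y → adj G z y B.≟ true) {xs = allFin n} (UP.allFin⁺ n)

  N-irrefl : ∀ {z} → z ∈ N z → ⊥
  N-irrefl {z} p = true≢false (trans (sym (N-adj p)) (Graph.irrfl G z))

  block : Fin n → List (Fin n)
  block z = z ∷ N z

  block-same : ∀ z {w} → ¬ Incident z → w ∈ block z → Same side z w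
  block-same z ¬inc (here refl) i = refl
  block-same z ¬inc (there p)     = free-neighbour z _ ¬inc (N-adj p)

  blocks : List (Fin n) → List (Fin n)
  blocks []       = []
  blocks (z ∷ zs) = block z ++ blocks zs

  length-blocks : ∀ zs → length (blocks zs) ≡ sumSuc (map (deg G) zs)
  length-blocks []       = refl
  length-blocks (z ∷ zs) = trans (LP.length-++ (block z)) (cong (suc (deg G z) +_) (length-blocks zs))

  blocks-same : ∀ {zs w} → All (λ z → ¬ Incident z) zs → w ∈ blocks zs → Σ (Fin n) λ z → z ∈ zs × Same side z w
  blocks-same {z ∷ zs} (¬inc ∷ ¬incs) p with ∈-++⁻ (block z) p
  ... | inj₁ q = z , here refl , block-same z ¬inc q
  ... | inj₂ q with blocks-same ¬incs q
  ...   | z′ , z′∈ , s = z′ , there z′∈ , s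

  blocks-unique : ∀ zs → All (λ z → ¬ Incident z) zs → AllPairs Apart zs → Unique (blocks zs)
  blocks-unique []       _              _        = []
  blocks-unique (z ∷ zs) (¬inc ∷ ¬incs) (d ∷ ap) =
    UP.++⁺ (All.tabulate (λ { p refl → N-irrefl p }) ∷ N-unique z) (blocks-unique zs ¬incs ap) disjoint
    where
    disjoint : ∀ {w} → ¬ (w ∈ block z × w ∈ blocks zs)
    disjoint (p , q) with blocks-same ¬incs q
    ... | z′ , z′∈ , s = All.lookup d z′∈ (λ i → trans (block-same z ¬inc p i) (sym (s i)))

  -- The blocks and the covered representatives are pairwise disjoint
  -- vertex sets, hence fit into the n vertices.
  split-fits : ∀ {R} (S : Split R) → sumSuc (map (deg G) (Split.zs S)) + length (Split.ps S) ≤ n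
  split-fits S = subst₂ _≤_ (cong (_+ length ps) (length-blocks zs)) (length-allFin n)
                   (subst (_≤ length (allFin n)) (LP.length-++ (blocks zs))
                     (unique-⊆-length-≤ unique (λ {w} _ → ∈-allFin w)))
    where
    zs = Split.zs S
    ps = Split.ps S
    unique : Unique (blocks zs ++ ps)
    unique = UP.++⁺ (blocks-unique zs (Split.free S) (Split.apart-z S)) (AP.map apart-≢ (Split.apart-p S)) disjoint
      where
      disjoint : ∀ {w} → ¬ (w ∈ blocks zs × w ∈ ps)
      disjoint (p , q) with blocks-same (Split.free S) p
      ... | z , z∈ , s = All.lookup (All.lookup (Split.apart-zp S) z∈) q s

  Meets : Fin n → Fin t → Set
  Meets p i = Same side p (u i) ⊎ Same side p (v i)

  meets? : ∀ p i → Dec (Meets p i)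
  meets? p i = same? side p (u i) ⊎-dec same? side p (v i)

  touched : Fin n → List (Fin t)
  touched p = filter (meets? p) (allFin t)

  end-meets : ∀ {p y i} → Same side p y → EndOf i y → Meets p i
  end-meets s (inj₁ refl) = inj₁ s
  end-meets s (inj₂ refl) = inj₂ s

  meets-end : ∀ {p i} → Meets p i → Σ (Fin n) λ a → EndOf i a × Same side p a
  meets-end (inj₁ s) = _ , inj₁ refl , s
  meets-end (inj₂ s) = _ , inj₂ refl , s

  -- Each neighbour y of a covered p is charged to a touched edge: the edge
  -- py itself if it is a cut edge, else an edge having y as an end.
  ChargedTo : Fin n → Fin n → Fin t → Set
  ChargedTo p y i = OnEdge i p y ⊎ (Same side p y × EndOf i y)

  covered-deg≤touched : ∀ p → Covered p → deg G p ≤ length (touched p)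
  covered-deg≤touched p cov = injection-length-≤ (ChargedTo p) (N-unique p) charge charge-injective
    where
    charge : ∀ {y} → y ∈ N p → Σ (Fin t) λ i → i ∈ touched p × ChargedTo p y i
    charge {y} y∈ with FP.any? (λ i → onEdge? i p y)
    ... | yes (i , e) = i , ∈-filter⁺ (meets? p) (∈-allFin i) (end-meets (λ _ → refl) (onEdge-end e)) , inj₁ e
    ... | no ¬e = i , ∈-filter⁺ (meets? p) (∈-allFin i) (end-meets s end) , inj₂ (s , end)
      where
      s : Same side p y
      s j = side-edge j p y (N-adj y∈) (λ e → ¬e (j , e))
      i = proj₁ (cov y s)
      end = proj₂ (cov y s)
    charge-injective : ∀ {x x′ i} → x ∈ N p → x′ ∈ N p → ChargedTo p x i → ChargedTo p x′ i → x ≡ x′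
    charge-injective _ _ (inj₁ e) (inj₁ e′) = onEdge-other e e′
    charge-injective {i = i} _ x′∈ (inj₁ e) (inj₂ (s′ , end′)) with ends-same i (onEdge-end e) end′ s′
    ... | refl = ⊥-elim (N-irrefl x′∈)
    charge-injective {i = i} x∈ _ (inj₂ (s , end)) (inj₁ e′) with ends-same i (onEdge-end e′) end s
    ... | refl = ⊥-elim (N-irrefl x∈)
    charge-injective {i = i} _ _ (inj₂ (s , end)) (inj₂ (s′ , end′)) =
      ends-same i end end′ (λ j → trans (sym (s j)) (s′ j))

  covered-deg≤t : ∀ p → Covered p → deg G p ≤ t
  covered-deg≤t p cov = ≤-trans (covered-deg≤touched p cov)
    (subst (length (touched p) ≤_) (length-allFin t) (LP.length-filter (meets? p) (allFin t)))

  -- Two covered representatives have degree sum ≤ 2t < σ, so they are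
  -- adjacent; being apart, they are joined by one of the cut edges.
  covered-adjacent : ∀ p p′ → Covered p → Covered p′ → Apart p p′ → Adj G p p′
  covered-adjacent p p′ cov cov′ d with adj G p p′ in eq
  ... | true  = refl
  ... | false = ⊥-elim (<-irrefl refl (≤-<-trans (≤-trans sum≥σ (+-mono-≤ (covered-deg≤t p cov) (covered-deg≤t p′ cov′))) 2t<σ))
    where
    sum≥σ = deg-sum p p′ (apart-≢ d) (λ a → true≢false (trans (sym a) eq))

  covered-joined : ∀ p p′ → Covered p → Covered p′ → Apart p p′ → Σ (Fin t) λ i → OnEdge i p p′
  covered-joined p p′ cov cov′ d with FP.any? (λ i → onEdge? i p p′)
  ... | yes r = r
  ... | no ¬e = ⊥-elim (d (λ i → side-edge i p p′ (covered-adjacent p p′ cov cov′ d) (λ e → ¬e (i , e))))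

  -- If p p′ is the cut edge i₀, the only edge touched by both classes is i₀,
  -- so deg p + deg p′ ≤ t + 1.
  covered-pair-deg-sum : ∀ p p′ → Covered p → Covered p′ → Apart p p′ → deg G p + deg G p′ ≤ suc t
  covered-pair-deg-sum p p′ cov cov′ d =
    ≤-trans (+-mono-≤ (covered-deg≤touched p cov) (covered-deg≤touched p′ cov′))
      (≤-trans (length-filter-+ (meets? p) (meets? p′) (allFin t))
        (subst (length (allFin t) + length both ≤_) (+-comm t 1)
          (+-mono-≤ (≤-reflexive (length-allFin t)) |both|≤1)))
    where
    i₀ = proj₁ (covered-joined p p′ cov cov′ d)
    e₀ = proj₂ (covered-joined p p′ cov cov′ d)
    both = filter (λ i → meets? p i ×-dec meets? p′ i) (allFin t)
    only-i₀ : ∀ {i} → i ∈ both → i ∈ (i₀ ∷ [])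
    only-i₀ {i} i∈ with ∈-filter⁻ (λ i → meets? p i ×-dec meets? p′ i) {xs = allFin t} i∈
    ... | _ , (m , m′) with i F.≟ i₀
    ...   | yes refl = here refl
    ...   | no i≢i₀ with meets-end m | meets-end m′
    ...     | a , end-a , s-a | b , end-b , s-b =
              ⊥-elim (onEdge-side e₀ (trans (s-a i₀) (trans (ends-agree i≢i₀ end-a end-b) (sym (s-b i₀)))))
    |both|≤1 : length both ≤ 1
    |both|≤1 = unique-⊆-length-≤ (UP.filter⁺ (λ i → meets? p i ×-dec meets? p′ i) {xs = allFin t} (UP.allFin⁺ t)) only-i₀

  -- Three covered representatives would be pairwise joined by cut edges;
  -- but a cut edge lies on no cycle.
  no-three-covered : ∀ p₁ p₂ p₃ → Covered p₁ → Covered p₂ → Covered p₃ →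
    Apart p₁ p₂ → Apart p₁ p₃ → Apart p₂ p₃ → ⊥
  no-three-covered p₁ p₂ p₃ c₁ c₂ c₃ d₁₂ d₁₃ d₂₃ = onEdge-side e (trans s₁₃ (sym s₂₃))
    where
    i₀ = proj₁ (covered-joined p₁ p₂ c₁ c₂ d₁₂)
    e = proj₂ (covered-joined p₁ p₂ c₁ c₂ d₁₂)
    s₁₃ : side p₁ i₀ ≡ side p₃ i₀
    s₁₃ = side-edge i₀ p₁ p₃ (covered-adjacent p₁ p₃ c₁ c₃ d₁₃) (λ e′ → apart-≢ d₂₃ (onEdge-other e e′))
    s₂₃ : side p₂ i₀ ≡ side p₃ i₀
    s₂₃ = side-edge i₀ p₂ p₃ (covered-adjacent p₂ p₃ c₂ c₃ d₂₃) (λ e′ → apart-≢ d₁₃ (onEdge-other (onEdge-sym e) e′))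

  free-pairs : ∀ zs → All (λ z → ¬ Incident z) zs → AllPairs Apart zs →
    AllPairs (λ a b → σ ≤ a + b) (map (deg G) zs)
  free-pairs []       _              _        = []
  free-pairs (z ∷ zs) (¬inc ∷ ¬incs) (d ∷ ap) =
    AllP.map⁺ (All.map (λ {w} → free-deg-sum z w ¬inc) d) ∷ free-pairs zs ¬incs ap

  free-bounds : ∀ zs {c} p → All (λ z → ¬ Incident z) zs → All (λ z → Apart z p) zs → deg G p ≤ c →
    All (λ d → σ ≤ d + c) (map (deg G) zs)
  free-bounds []       p _              _        _   = []
  free-bounds (z ∷ zs) p (¬inc ∷ ¬incs) (d ∷ ds) p≤c =
    ≤-trans (free-deg-sum z p ¬inc d) (+-monoʳ-≤ (deg G z) p≤c) ∷ free-bounds zs p ¬incs ds p≤c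

  profile-of : ∀ zs ps → length zs + length ps ≡ suc t → All (λ z → ¬ Incident z) zs → All Covered ps →
    AllPairs Apart zs → AllPairs Apart ps → All (λ z → All (Apart z) ps) zs →
    sumSuc (map (deg G) zs) + length ps ≤ n → Profile n t σ
  profile-of zs [] |zs+ps| free _ apart-z _ _ fits =
    noCovered (map (deg G) zs) (trans (LP.length-map (deg G) zs) (trans (sym (+-identityʳ _)) |zs+ps|))
      (free-pairs zs free apart-z) (subst (_≤ n) (+-identityʳ _) fits)
  profile-of zs (p ∷ []) |zs+ps| free (cov ∷ []) _ _ apart-zp fits =
    oneCovered (map (deg G) zs)
      (trans (LP.length-map (deg G) zs) (suc-injective (trans (+-comm 1 (length zs)) |zs+ps|)))
      (free-bounds zs p free (All.map All.head apart-zp) (covered-deg≤t p cov)) fits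
  profile-of zs (p ∷ p′ ∷ []) |zs+ps| free (cov ∷ cov′ ∷ []) _ ((d ∷ []) ∷ _) apart-zp fits
    with deg G p ≤? deg G p′
  ... | yes p≤p′ = twoCovered (map (deg G) zs) (deg G p) |zs|+1
        (≤-trans (+-monoʳ-≤ (deg G p) p≤p′) (covered-pair-deg-sum p p′ cov cov′ d))
        (free-bounds zs p free (All.map All.head apart-zp) ≤-refl) fits
    where
    |zs|+1 : suc (length (map (deg G) zs)) ≡ t
    |zs|+1 = trans (cong suc (LP.length-map (deg G) zs)) (suc-injective (trans (+-comm 2 (length zs)) |zs+ps|))
  ... | no p≰p′ = twoCovered (map (deg G) zs) (deg G p′) |zs|+1
        (≤-trans (+-monoˡ-≤ (deg G p′) (<⇒≤ (≰⇒> p≰p′))) (covered-pair-deg-sum p p′ cov cov′ d))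
        (free-bounds zs p′ free (All.map (All.head ∘ All.tail) apart-zp) ≤-refl) fits
    where
    |zs|+1 : suc (length (map (deg G) zs)) ≡ t
    |zs|+1 = trans (cong suc (LP.length-map (deg G) zs)) (suc-injective (trans (+-comm 2 (length zs)) |zs+ps|))
  profile-of zs (p₁ ∷ p₂ ∷ p₃ ∷ ps) _ _ (c₁ ∷ c₂ ∷ c₃ ∷ _) _ ((d₁₂ ∷ d₁₃ ∷ _) ∷ (d₂₃ ∷ _) ∷ _) _ _ =
    ⊥-elim (no-three-covered p₁ p₂ p₃ c₁ c₂ c₃ d₁₂ d₁₃ d₂₃)

  profile : Fin n → Profile n t σ
  profile x₀ with representatives x₀
  ... | R , |R| , apart-R with split R apart-R
  ... | S = profile-of (Split.zs S) (Split.ps S) (trans (Split.|zs+ps| S) |R|) (Split.free S) (Split.covered S)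
              (Split.apart-z S) (Split.apart-p S) (Split.apart-zp S) (split-fits S)

theorem3p4 : ∀ (k n : ℕ) → 5 ≤ k → (G : Graph n) → Connected G →
    k * k + k ≤ n →
    (k / 2) * (k * (k ∸ 2)) + k * k ∸ 5 * k + 3 ≤ n * (k ∸ 4) →
    (∀ (x y : Fin n) → x ≢ y → ¬ Adj G x y →
    2 * n ∸ 2 * k + 1 ≤ k * (deg G x + deg G y)) →
    AtMostCutEdges G (k ∸ 2)
theorem3p4 (suc (suc (suc (suc (suc a))))) n (s≤s (s≤s (s≤s (s≤s (s≤s z≤n))))) G conn big-n big-n₂ hyp es ues cut-es
  with length es ≤? 3 + a
... | yes few = few
... | no many = ⊥-elim (¬¬-Π-Fin (λ i → ¬¬-Π-Fin (λ x → ¬¬-excluded-middle)) no-sides)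
  where
  open Threshold a n
  E : CutEdges G t
  E = cutEdges-prefix G t es ues cut-es (≰⇒> many)
  deg-sum : ∀ x y → x ≢ y → ¬ Adj G x y → σ ≤ deg G x + deg G y
  deg-sum x y x≢y ¬adj = σ-≤ (deg G x + deg G y) (hyp x y x≢y ¬adj)
  no-sides : (∀ i x → Dec (Reach (removeEdge G (CutEdges.u E i) (CutEdges.v E i)) (CutEdges.u E i) x)) → ⊥
  no-sides side? = profile-impossible big-n big-n₂
    (CutEdgeAnalysis.profile G conn E side? σ deg-sum (2t<σ big-n) (CutEdges.u E F.zero))
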